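{- Every formula $F$ can be converted into a logically equivalent formula in conjunctive normal form, i.e. there is a formula $F'$ that is a conjunction of clauses with $F\models F'$ and $F'\models F$.
   Context: Truth domain: a linear symmetrical hedge algebra $AX=(X,G,H,\le)$ with $G=\{\bot,\mathsf{False},\mathsf{W},\mathsf{True},\top\}$, $\bot<\mathsf{False}<\mathsf{W}<\mathsf{True}<\top$ ($\bot,\mathsf{W},\top$ least, neutral, greatest), hedges $H=H^+\cup H^-$ (each part linearly ordered), $X$ the finite linearly ordered set of terms $h_n\cdots h_1a$. For $x=h_n\cdots h_1a$ with $a\in\{\mathsf{True},\mathsf{False}\}$, $\overline{x}=h_n\cdots h_1a'$ with $a'$ the other of $\mathsf{True},\mathsf{False}$ (unique contradictory element). Operations on $X$: $\alpha\wedge\beta=\min(\alpha,\beta)$, $\alpha\vee\beta=\max(\alpha,\beta)$, $\neg\alpha=\overline{\alpha}$, $\alpha\to\beta=(\neg\alpha)\vee\beta$. Syntax: atoms are propositional variables or constant symbols (elements of $X$); a literal is $A^\alpha$ with $A$ an atom and $\alpha$ a constant; formulae are literals and constants, closed under $\neg$ and the binary connectives $\vee,\wedge,\to,\leftrightarrow$. A clause is a finite disjunction $l_1\vee\cdots\vee l_n$ of literals; a formula is in conjunctive normal form if it is a conjunction of clauses. Semantics: an interpretation $I$ assigns each atom $A$ a value $I(A)\in X$ (constants denote themselves). If $I(A)=\alpha_1$: $I(A^{\alpha_2})=\alpha_1\wedge\alpha_2$ if $\alpha_1,\alpha_2>\mathsf{W}$; $=\neg(\alpha_1\vee\alpha_2)$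 if $\alpha_1,\alpha_2\le\mathsf{W}$; $=(\neg\alpha_1)\vee\alpha_2$ if $\alpha_1>\mathsf{W}\ge\alpha_2$; $=\alpha_1\vee(\neg\alpha_2)$ if $\alpha_1\le\mathsf{W}<\alpha_2$. Recursively $I(P\vee Q)=I(P)\vee I(Q)$, $I(P\wedge Q)=I(P)\wedge I(Q)$, $I(\neg P)=\neg I(P)$, $I(P\to Q)=I(P)\to I(Q)$, and $I(P\leftrightarrow Q)=I((P\to Q)\wedge(Q\to P))$. $A\models B$ iff for every interpretation $I$, $I(A)>\mathsf{W}$ implies $I(B)>\mathsf{W}$; $A$ and $B$ are logically equivalent iff $A\models B$ and $B\models A$. -}

module Defs where

open import Data.Bool using (Bool; true; false; not)
open import Data.Nat using (ℕ)
open import Data.List using (List; [])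
open import Data.List.Membership.Propositional using (_∈_)
open import Data.Product using (Σ; _×_; ∃)
open import Data.Sum using (_⊎_)
open import Relation.Binary.PropositionalEquality using (_≡_; _≢_)
open import Relation.Binary.Structures using (IsDecTotalOrder)
open import Relation.Nullary using (yes; no)

-- The truth domain: a finite linear symmetrical hedge algebra
-- AX = (X, G, H, ≤) with generators ⊥ < False < W < True < ⊤.
-- The elements of X are ⊥, W, ⊤ and the hedge-terms  h_n ⋯ h_1 a
-- (a ∈ {True, False});  `term hs b` denotes the term obtained by applying
-- the hedge string hs (h_1 first) to True (b = true) or False (b = false).

record TruthDomain : Set₁ where
  field
    X      : Set
    H      : Set
    _≤_    : X → X → Set
    isDecTotalOrder : IsDecTotalOrder _≡_ _≤_
    ⊥ False W True ⊤ : X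
    term   : List H → Bool → X
    term-True  : term [] true ≡ True
    term-False : term [] false ≡ False
    cover  : ∀ x → (x ≡ ⊥ ⊎ x ≡ W ⊎ x ≡ ⊤) ⊎ ∃ λ hs → ∃ λ b → x ≡ term hs b
    elems    : List X
    complete : ∀ x → x ∈ elems
    ⊥<F : ⊥ ≤ False × ⊥ ≢ False
    F<W : False ≤ W × False ≢ W
    W<T : W ≤ True × W ≢ True
    T<⊤ : True ≤ ⊤ × True ≢ ⊤
    ⊥-least    : ∀ x → ⊥ ≤ x
    ⊤-greatest : ∀ x → x ≤ ⊤
    neg      : X → X
    neg-term : ∀ hs b → neg (term hs b) ≡ term hs (not b)
    neg-⊥    : neg ⊥ ≡ ⊤
    neg-⊤    : neg ⊤ ≡ ⊥
    neg-W    : neg W ≡ W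
    neg-antitone : ∀ {x y} → x ≤ y → neg y ≤ neg x

  open IsDecTotalOrder isDecTotalOrder public using (_≤?_)

  _∧_ : X → X → X
  a ∧ b with a ≤? b
  ... | yes _ = a
  ... | no  _ = b

  _∨_ : X → X → X
  a ∨ b with a ≤? b
  ... | yes _ = b
  ... | no  _ = a

  ¬_ : X → X
  ¬ a = neg a

  _⇒_ : X → X → X
  a ⇒ b = (¬ a) ∨ b

  Designated : X → Set
  Designated a = W ≤ a × W ≢ a

module Syntax (T : TruthDomain) where
  open TruthDomain T

  data Atom : Set where
    var   : ℕ → Atom
    const : X → Atom

  data Formula : Set where
    lit   : Atom → X → Formula
    con   : X → Formula
    ~_    : Formula → Formula
    _∨ᶠ_  : Formula → Formula → Formula
    _∧ᶠ_  : Formula → Formula → Formula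
    _→ᶠ_  : Formula → Formula → Formula
    _↔ᶠ_  : Formula → Formula → Formula

  data IsClause : Formula → Set where
    lit-clause : ∀ A α → IsClause (lit A α)
    or-clause  : ∀ {C D} → IsClause C → IsClause D → IsClause (C ∨ᶠ D)

  data IsCNF : Formula → Set where
    clause-cnf : ∀ {C} → IsClause C → IsCNF C
    and-cnf    : ∀ {F G} → IsCNF F → IsCNF G → IsCNF (F ∧ᶠ G)

  Interpretation : Set
  Interpretation = ℕ → X

  atomVal : Interpretation → Atom → X
  atomVal I (var n)   = I n
  atomVal I (const c) = c

  -- value of the literal A^α2 when I(A) = α1  (α > W  iff  not α ≤ W)
  litVal : X → X → X
  litVal a1 a2 with a1 ≤? W | a2 ≤? W
  ... | no _  | no _  = a1 ∧ a2
  ... | yes _ | yes _ = ¬ (a1 ∨ a2)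
  ... | no _  | yes _ = (¬ a1) ∨ a2
  ... | yes _ | no _  = a1 ∨ (¬ a2)

  eval : Interpretation → Formula → X
  eval I (lit A α) = litVal (atomVal I A) α
  eval I (con c)   = c
  eval I (~ P)     = ¬ (eval I P)
  eval I (P ∨ᶠ Q)  = eval I P ∨ eval I Q
  eval I (P ∧ᶠ Q)  = eval I P ∧ eval I Q
  eval I (P →ᶠ Q)  = eval I P ⇒ eval I Q
  eval I (P ↔ᶠ Q)  = (eval I P ⇒ eval I Q) ∧ (eval I Q ⇒ eval I P)

  _⊨_ : Formula → Formula → Set
  A ⊨ B = ∀ (I : Interpretation) → Designated (eval I A) → Designated (eval I B)

-- Only the position of a truth value relative to W matters for ⊨, and min, max,
-- contradiction and the value of a literal all respect this position.  So every
-- formula is evaluated faithfully in Kleene's strong three-valued logic, where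
-- the usual CNF transformation (push negations to the literals, using that the
-- literal A^ᾱ behaves as the negation of A^α, then distribute ∨ over ∧) preserves
-- the value exactly.

module Submission where

open import Defs
open import Data.Bool using (Bool; true; false; not)
open import Data.Bool.Properties using (not-involutive)
open import Data.Empty using (⊥-elim)
open import Data.List using (List; []; _∷_; _++_; map; cartesianProductWith)
open import Data.Product using (Σ; _×_; _,_; proj₁)
open import Data.Sum using (inj₁; inj₂)
open import Relation.Binary.Bundles using (DecTotalOrder)
open import Relation.Binary.Definitions using (tri<; tri≈; tri>)
open import Relation.Binary.PropositionalEquality
  using (_≡_; refl; sym; trans; cong; cong₂; subst; module ≡-Reasoning)
open import Relation.Nullary using (yes; no)

open ≡-Reasoning

data Kleene : Set where
  F U T : Kleene

infix  8 ∼_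
infixr 7 _⊓_
infixr 6 _⊔_
infix  5 _⇔_ _≤ₖ_

_⊓_ : Kleene → Kleene → Kleene
F ⊓ _ = F
U ⊓ F = F
U ⊓ _ = U
T ⊓ y = y

_⊔_ : Kleene → Kleene → Kleene
F ⊔ y = y
U ⊔ T = T
U ⊔ _ = U
T ⊔ _ = T

∼_ : Kleene → Kleene
∼ F = T
∼ U = U
∼ T = F

_⇔_ : Kleene → Kleene → Kleene
x ⇔ y = (∼ x ⊔ y) ⊓ (∼ y ⊔ x)

data _≤ₖ_ : Kleene → Kleene → Set where
  F≤  : ∀ {y} → F ≤ₖ y
  U≤U : U ≤ₖ U
  U≤T : U ≤ₖ T
  T≤T : T ≤ₖ T

⊓-comm : ∀ x y → x ⊓ y ≡ y ⊓ x
⊓-comm F F = refl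
⊓-comm F U = refl
⊓-comm F T = refl
⊓-comm U F = refl
⊓-comm U U = refl
⊓-comm U T = refl
⊓-comm T F = refl
⊓-comm T U = refl
⊓-comm T T = refl

⊔-comm : ∀ x y → x ⊔ y ≡ y ⊔ x
⊔-comm F F = refl
⊔-comm F U = refl
⊔-comm F T = refl
⊔-comm U F = refl
⊔-comm U U = refl
⊔-comm U T = refl
⊔-comm T F = refl
⊔-comm T U = refl
⊔-comm T T = refl

⊓-assoc : ∀ x y z → (x ⊓ y) ⊓ z ≡ x ⊓ (y ⊓ z)
⊓-assoc F y z = refl
⊓-assoc T y z = refl
⊓-assoc U F z = refl
⊓-assoc U T z = refl
⊓-assoc U U F = refl
⊓-assoc U U U = refl
⊓-assoc U U T = refl

⊔-assoc : ∀ x y z → (x ⊔ y) ⊔ z ≡ x ⊔ (y ⊔ z)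
⊔-assoc F y z = refl
⊔-assoc T y z = refl
⊔-assoc U F z = refl
⊔-assoc U T z = refl
⊔-assoc U U F = refl
⊔-assoc U U U = refl
⊔-assoc U U T = refl

⊔-distribˡ-⊓ : ∀ x y z → x ⊔ (y ⊓ z) ≡ (x ⊔ y) ⊓ (x ⊔ z)
⊔-distribˡ-⊓ F y z = refl
⊔-distribˡ-⊓ T y z = refl
⊔-distribˡ-⊓ U F F = refl
⊔-distribˡ-⊓ U F U = refl
⊔-distribˡ-⊓ U F T = refl
⊔-distribˡ-⊓ U U F = refl
⊔-distribˡ-⊓ U U U = refl
⊔-distribˡ-⊓ U U T = refl
⊔-distribˡ-⊓ U T F = refl
⊔-distribˡ-⊓ U T U = refl
⊔-distribˡ-⊓ U T T = refl

⊔-distribʳ-⊓ : ∀ x y z → (y ⊓ z) ⊔ x ≡ (y ⊔ x) ⊓ (z ⊔ x)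
⊔-distribʳ-⊓ x y z = begin
  (y ⊓ z) ⊔ x           ≡⟨ ⊔-comm (y ⊓ z) x ⟩
  x ⊔ (y ⊓ z)           ≡⟨ ⊔-distribˡ-⊓ x y z ⟩
  (x ⊔ y) ⊓ (x ⊔ z)     ≡⟨ cong₂ _⊓_ (⊔-comm x y) (⊔-comm x z) ⟩
  (y ⊔ x) ⊓ (z ⊔ x)     ∎

⊓-identityʳ : ∀ x → x ⊓ T ≡ x
⊓-identityʳ F = refl
⊓-identityʳ U = refl
⊓-identityʳ T = refl

⊔-identityʳ : ∀ x → x ⊔ F ≡ x
⊔-identityʳ F = refl
⊔-identityʳ U = refl
⊔-identityʳ T = refl

⊔-zeroʳ : ∀ x → x ⊔ T ≡ T
⊔-zeroʳ F = refl
⊔-zeroʳ U = refl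
⊔-zeroʳ T = refl

∼-involutive : ∀ x → ∼ ∼ x ≡ x
∼-involutive F = refl
∼-involutive U = refl
∼-involutive T = refl

∼-distrib-⊓ : ∀ x y → ∼ (x ⊓ y) ≡ ∼ x ⊔ ∼ y
∼-distrib-⊓ F y = refl
∼-distrib-⊓ T y = refl
∼-distrib-⊓ U F = refl
∼-distrib-⊓ U U = refl
∼-distrib-⊓ U T = refl

∼-distrib-⊔ : ∀ x y → ∼ (x ⊔ y) ≡ ∼ x ⊓ ∼ y
∼-distrib-⊔ F y = refl
∼-distrib-⊔ T y = refl
∼-distrib-⊔ U F = refl
∼-distrib-⊔ U U = refl
∼-distrib-⊔ U T = refl

⇔-identityˡ : ∀ y → T ⇔ y ≡ y
⇔-identityˡ F = refl
⇔-identityˡ U = refl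
⇔-identityˡ T = refl

⇔-identityʳ : ∀ x → x ⇔ T ≡ x
⇔-identityʳ F = refl
⇔-identityʳ U = refl
⇔-identityʳ T = refl

⇔-∼ʳ : ∀ x y → x ⇔ ∼ y ≡ ∼ (x ⇔ y)
⇔-∼ʳ F F = refl
⇔-∼ʳ F U = refl
⇔-∼ʳ F T = refl
⇔-∼ʳ U F = refl
⇔-∼ʳ U U = refl
⇔-∼ʳ U T = refl
⇔-∼ʳ T F = refl
⇔-∼ʳ T U = refl
⇔-∼ʳ T T = refl

∼-⊔-≡-⇔ : ∀ {x y} → x ≤ₖ U → y ≤ₖ U → ∼ (x ⊔ y) ≡ x ⇔ y
∼-⊔-≡-⇔ F≤  F≤  = refl
∼-⊔-≡-⇔ F≤  U≤U = refl
∼-⊔-≡-⇔ U≤U F≤  = refl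
∼-⊔-≡-⇔ U≤U U≤U = refl

⊓-≤ : ∀ {x y} → x ≤ₖ y → x ⊓ y ≡ x
⊓-≤ F≤  = refl
⊓-≤ U≤U = refl
⊓-≤ U≤T = refl
⊓-≤ T≤T = refl

⊔-≤ : ∀ {x y} → x ≤ₖ y → x ⊔ y ≡ y
⊔-≤ F≤  = refl
⊔-≤ U≤U = refl
⊔-≤ U≤T = refl
⊔-≤ T≤T = refl

pol : Bool → Kleene → Kleene
pol true  x = x
pol false x = ∼ x

meet : Bool → Kleene → Kleene → Kleene
meet true  = _⊓_
meet false = _⊔_

pol-⊓ : ∀ p x y → pol p (x ⊓ y) ≡ meet p (pol p x) (pol p y)
pol-⊓ true  x y = refl
pol-⊓ false x y = ∼-distrib-⊓ x y

pol-⊔ : ∀ p x y → pol p (x ⊔ y) ≡ meet (not p) (pol p x) (pol p y)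
pol-⊔ true  x y = refl
pol-⊔ false x y = ∼-distrib-⊔ x y

pol-not : ∀ p x → pol (not p) x ≡ pol p (∼ x)
pol-not true  x = refl
pol-not false x = sym (∼-involutive x)

⇔-pol : ∀ p x y → x ⇔ pol p y ≡ pol p (x ⇔ y)
⇔-pol true  x y = refl
⇔-pol false x y = ⇔-∼ʳ x y

module KleeneSemantics (𝒯 : TruthDomain) where

  open TruthDomain 𝒯
  open Syntax 𝒯

  decTotalOrder : DecTotalOrder _ _ _
  decTotalOrder = record { isDecTotalOrder = isDecTotalOrder }

  open DecTotalOrder decTotalOrder using () renaming (trans to ≤-trans)
  open import Relation.Binary.Properties.DecTotalOrder decTotalOrder
    using (_<_; <-compare; <⇒≱; ≰⇒>; ≰⇒≥)

  neg-involutive : ∀ x → neg (neg x) ≡ x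
  neg-involutive x with cover x
  ... | inj₁ (inj₁ refl)        = trans (cong neg neg-⊥) neg-⊤
  ... | inj₁ (inj₂ (inj₁ refl)) = trans (cong neg neg-W) neg-W
  ... | inj₁ (inj₂ (inj₂ refl)) = trans (cong neg neg-⊤) neg-⊥
  ... | inj₂ (hs , b , refl)    = begin
    neg (neg (term hs b))     ≡⟨ cong neg (neg-term hs b) ⟩
    neg (term hs (not b))     ≡⟨ neg-term hs (not b) ⟩
    term hs (not (not b))     ≡⟨ cong (term hs) (not-involutive b) ⟩
    term hs b                 ∎

  neg-strictly-antitone : ∀ {x y} → x < y → neg y < neg x
  neg-strictly-antitone {x} {y} (x≤y , x≢y) =
    neg-antitone x≤y , λ eq → x≢y (begin
      x               ≡⟨ sym (neg-involutive x) ⟩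
      neg (neg x)     ≡⟨ cong neg (sym eq) ⟩
      neg (neg y)     ≡⟨ neg-involutive y ⟩
      y               ∎)

  kleene : X → Kleene
  kleene x with <-compare W x
  ... | tri< _ _ _ = T
  ... | tri≈ _ _ _ = U
  ... | tri> _ _ _ = F

  kleene-> : ∀ {x} → W < x → kleene x ≡ T
  kleene-> {x} W<x with <-compare W x
  ... | tri< _ _ _    = refl
  ... | tri≈ W≮x _ _  = ⊥-elim (W≮x W<x)
  ... | tri> W≮x _ _  = ⊥-elim (W≮x W<x)

  kleene-< : ∀ {x} → x < W → kleene x ≡ F
  kleene-< {x} x<W with <-compare W x
  ... | tri< _ _ x≯W  = ⊥-elim (x≯W x<W)
  ... | tri≈ _ _ x≯W  = ⊥-elim (x≯W x<W)
  ... | tri> _ _ _    = refl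

  kleene-W : kleene W ≡ U
  kleene-W with <-compare W W
  ... | tri< _ W≢W _ = ⊥-elim (W≢W refl)
  ... | tri≈ _ _ _   = refl
  ... | tri> _ W≢W _ = ⊥-elim (W≢W refl)

  kleene-True : kleene True ≡ T
  kleene-True = kleene-> W<T

  kleene-False : kleene False ≡ F
  kleene-False = kleene-< F<W

  kleene≡T⇒designated : ∀ {x} → kleene x ≡ T → Designated x
  kleene≡T⇒designated {x} with <-compare W x
  ... | tri< W<x _ _ = λ _ → W<x
  ... | tri≈ _ _ _   = λ ()
  ... | tri> _ _ _   = λ ()

  kleene-mono : ∀ {a b} → a ≤ b → kleene a ≤ₖ kleene b
  kleene-mono {a} {b} a≤b with <-compare W a | <-compare W b
  ... | tri> _ _ _   | _            = F≤
  ... | tri≈ _ _ _   | tri< _ _ _   = U≤T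
  ... | tri≈ _ _ _   | tri≈ _ _ _   = U≤U
  ... | tri≈ _ W≡a _ | tri> _ _ b<W = ⊥-elim (<⇒≱ b<W (subst (_≤ b) (sym W≡a) a≤b))
  ... | tri< _ _ _   | tri< _ _ _   = T≤T
  ... | tri< W<a _ _ | tri≈ _ W≡b _ = ⊥-elim (<⇒≱ W<a (subst (a ≤_) (sym W≡b) a≤b))
  ... | tri< W<a _ _ | tri> _ _ b<W = ⊥-elim (<⇒≱ W<a (≤-trans a≤b (proj₁ b<W)))

  kleene-≤W : ∀ {a} → a ≤ W → kleene a ≤ₖ U
  kleene-≤W {a} a≤W = subst (kleene a ≤ₖ_) kleene-W (kleene-mono a≤W)

  kleene-∧ : ∀ a b → kleene (a ∧ b) ≡ kleene a ⊓ kleene b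
  kleene-∧ a b with a ≤? b
  ... | yes a≤b = sym (⊓-≤ (kleene-mono a≤b))
  ... | no  a≰b =
    trans (sym (⊓-≤ (kleene-mono (≰⇒≥ a≰b)))) (⊓-comm (kleene b) (kleene a))

  kleene-∨ : ∀ a b → kleene (a ∨ b) ≡ kleene a ⊔ kleene b
  kleene-∨ a b with a ≤? b
  ... | yes a≤b = sym (⊔-≤ (kleene-mono a≤b))
  ... | no  a≰b =
    trans (sym (⊔-≤ (kleene-mono (≰⇒≥ a≰b)))) (⊔-comm (kleene b) (kleene a))

  kleene-¬ : ∀ a → kleene (¬ a) ≡ ∼ kleene a
  kleene-¬ a with <-compare W a
  ... | tri< W<a _ _ = kleene-< (subst (neg a <_) neg-W (neg-strictly-antitone W<a))
  ... | tri≈ _ W≡a _ =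
    subst (λ x → kleene (neg x) ≡ U) W≡a (trans (cong kleene neg-W) kleene-W)
  ... | tri> _ _ a<W = kleene-> (subst (_< neg a) neg-W (neg-strictly-antitone a<W))

  kleene-⇒ : ∀ a b → kleene (a ⇒ b) ≡ ∼ kleene a ⊔ kleene b
  kleene-⇒ a b = trans (kleene-∨ (¬ a) b) (cong (_⊔ kleene b) (kleene-¬ a))

  kleene-litVal : ∀ a b → kleene (litVal a b) ≡ kleene a ⇔ kleene b
  kleene-litVal a b with a ≤? W | b ≤? W
  ... | no a≰W | no b≰W
    rewrite kleene-∧ a b | kleene-> (≰⇒> a≰W) | kleene-> (≰⇒> b≰W) = refl
  ... | yes a≤W | yes b≤W
    rewrite kleene-¬ (a ∨ b) | kleene-∨ a b = ∼-⊔-≡-⇔ (kleene-≤W a≤W) (kleene-≤W b≤W)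
  ... | no a≰W | yes _
    rewrite kleene-⇒ a b | kleene-> (≰⇒> a≰W) = sym (⇔-identityˡ (kleene b))
  ... | yes _ | no b≰W
    rewrite kleene-∨ a (¬ b) | kleene-¬ b | kleene-> (≰⇒> b≰W) =
      trans (⊔-identityʳ (kleene a)) (sym (⇔-identityʳ (kleene a)))

  ⟦_⟧ : Formula → Interpretation → Kleene
  ⟦ lit A α ⟧ I = kleene (atomVal I A) ⇔ kleene α
  ⟦ con c ⟧   I = kleene c
  ⟦ ~ P ⟧     I = ∼ ⟦ P ⟧ I
  ⟦ P ∨ᶠ Q ⟧  I = ⟦ P ⟧ I ⊔ ⟦ Q ⟧ I
  ⟦ P ∧ᶠ Q ⟧  I = ⟦ P ⟧ I ⊓ ⟦ Q ⟧ I
  ⟦ P →ᶠ Q ⟧  I = ∼ ⟦ P ⟧ I ⊔ ⟦ Q ⟧ I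
  ⟦ P ↔ᶠ Q ⟧  I = ⟦ P ⟧ I ⇔ ⟦ Q ⟧ I

  kleene-eval : ∀ I P → kleene (eval I P) ≡ ⟦ P ⟧ I
  kleene-eval I (lit A α) = kleene-litVal (atomVal I A) α
  kleene-eval I (con c)   = refl
  kleene-eval I (~ P)     = trans (kleene-¬ (eval I P)) (cong ∼_ (kleene-eval I P))
  kleene-eval I (P ∨ᶠ Q)  =
    trans (kleene-∨ (eval I P) (eval I Q)) (cong₂ _⊔_ (kleene-eval I P) (kleene-eval I Q))
  kleene-eval I (P ∧ᶠ Q)  =
    trans (kleene-∧ (eval I P) (eval I Q)) (cong₂ _⊓_ (kleene-eval I P) (kleene-eval I Q))
  kleene-eval I (P →ᶠ Q)  =
    trans (kleene-⇒ (eval I P) (eval I Q))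
          (cong₂ (λ x y → ∼ x ⊔ y) (kleene-eval I P) (kleene-eval I Q))
  kleene-eval I (P ↔ᶠ Q)  = begin
    kleene ((eval I P ⇒ eval I Q) ∧ (eval I Q ⇒ eval I P))
      ≡⟨ kleene-∧ (eval I P ⇒ eval I Q) (eval I Q ⇒ eval I P) ⟩
    kleene (eval I P ⇒ eval I Q) ⊓ kleene (eval I Q ⇒ eval I P)
      ≡⟨ cong₂ _⊓_ (kleene-⇒ (eval I P) (eval I Q)) (kleene-⇒ (eval I Q) (eval I P)) ⟩
    kleene (eval I P) ⇔ kleene (eval I Q)
      ≡⟨ cong₂ _⇔_ (kleene-eval I P) (kleene-eval I Q) ⟩
    ⟦ P ⟧ I ⇔ ⟦ Q ⟧ I
      ∎

  ⟦⟧-≡⇒⊨ : ∀ {A B} → (∀ I → ⟦ A ⟧ I ≡ ⟦ B ⟧ I) → A ⊨ B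
  ⟦⟧-≡⇒⊨ {A} {B} A≡B I A-designated = kleene≡T⇒designated (begin
    kleene (eval I B)   ≡⟨ kleene-eval I B ⟩
    ⟦ B ⟧ I             ≡⟨ sym (A≡B I) ⟩
    ⟦ A ⟧ I             ≡⟨ sym (kleene-eval I A) ⟩
    kleene (eval I A)   ≡⟨ kleene-> A-designated ⟩
    T                   ∎)

module ClausalForm (𝒯 : TruthDomain) where

  open TruthDomain 𝒯
  open Syntax 𝒯
  open KleeneSemantics 𝒯

  Literal : Set
  Literal = Atom × X

  Clause : Set
  Clause = List Literal

  CNF : Set
  CNF = List Clause

  ⟦_⟧ᶜ : Clause → Interpretation → Kleene
  ⟦ [] ⟧ᶜ          I = F
  ⟦ (A , α) ∷ c ⟧ᶜ I = ⟦ lit A α ⟧ I ⊔ ⟦ c ⟧ᶜ I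

  ⟦_⟧ⁿ : CNF → Interpretation → Kleene
  ⟦ [] ⟧ⁿ     I = T
  ⟦ c ∷ cs ⟧ⁿ I = ⟦ c ⟧ᶜ I ⊓ ⟦ cs ⟧ⁿ I

  -- The empty clause and the empty conjunction are written as the literals
  -- True^False and True^True, whose values are False and True.
  clauseFormula : Clause → Formula
  clauseFormula []            = lit (const True) False
  clauseFormula ((A , α) ∷ c) = lit A α ∨ᶠ clauseFormula c

  cnfFormula : CNF → Formula
  cnfFormula []       = lit (const True) True
  cnfFormula (c ∷ cs) = clauseFormula c ∧ᶠ cnfFormula cs

  clauseFormula-isClause : ∀ c → IsClause (clauseFormula c)
  clauseFormula-isClause []            = lit-clause (const True) False
  clauseFormula-isClause ((A , α) ∷ c) = or-clause (lit-clause A α) (clauseFormula-isClause c)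

  cnfFormula-isCNF : ∀ cs → IsCNF (cnfFormula cs)
  cnfFormula-isCNF []       = clause-cnf (lit-clause (const True) True)
  cnfFormula-isCNF (c ∷ cs) =
    and-cnf (clause-cnf (clauseFormula-isClause c)) (cnfFormula-isCNF cs)

  module _ (I : Interpretation) where

    ⟦clauseFormula⟧ : ∀ c → ⟦ clauseFormula c ⟧ I ≡ ⟦ c ⟧ᶜ I
    ⟦clauseFormula⟧ [] rewrite kleene-True | kleene-False = refl
    ⟦clauseFormula⟧ ((A , α) ∷ c) = cong (⟦ lit A α ⟧ I ⊔_) (⟦clauseFormula⟧ c)

    ⟦cnfFormula⟧ : ∀ cs → ⟦ cnfFormula cs ⟧ I ≡ ⟦ cs ⟧ⁿ I
    ⟦cnfFormula⟧ [] rewrite kleene-True = refl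
    ⟦cnfFormula⟧ (c ∷ cs) = cong₂ _⊓_ (⟦clauseFormula⟧ c) (⟦cnfFormula⟧ cs)

    ⟦++⟧ᶜ : ∀ c d → ⟦ c ++ d ⟧ᶜ I ≡ ⟦ c ⟧ᶜ I ⊔ ⟦ d ⟧ᶜ I
    ⟦++⟧ᶜ []            d = refl
    ⟦++⟧ᶜ ((A , α) ∷ c) d =
      trans (cong (⟦ lit A α ⟧ I ⊔_) (⟦++⟧ᶜ c d))
            (sym (⊔-assoc (⟦ lit A α ⟧ I) (⟦ c ⟧ᶜ I) (⟦ d ⟧ᶜ I)))

    ⟦++⟧ⁿ : ∀ cs ds → ⟦ cs ++ ds ⟧ⁿ I ≡ ⟦ cs ⟧ⁿ I ⊓ ⟦ ds ⟧ⁿ I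
    ⟦++⟧ⁿ []       ds = refl
    ⟦++⟧ⁿ (c ∷ cs) ds =
      trans (cong (⟦ c ⟧ᶜ I ⊓_) (⟦++⟧ⁿ cs ds))
            (sym (⊓-assoc (⟦ c ⟧ᶜ I) (⟦ cs ⟧ⁿ I) (⟦ ds ⟧ⁿ I)))

    ⟦map-++⟧ : ∀ c ds → ⟦ map (c ++_) ds ⟧ⁿ I ≡ ⟦ c ⟧ᶜ I ⊔ ⟦ ds ⟧ⁿ I
    ⟦map-++⟧ c []       = sym (⊔-zeroʳ (⟦ c ⟧ᶜ I))
    ⟦map-++⟧ c (d ∷ ds) =
      trans (cong₂ _⊓_ (⟦++⟧ᶜ c d) (⟦map-++⟧ c ds))
            (sym (⊔-distribˡ-⊓ (⟦ c ⟧ᶜ I) (⟦ d ⟧ᶜ I) (⟦ ds ⟧ⁿ I)))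

    ⟦cartesianProduct-++⟧ : ∀ cs ds →
      ⟦ cartesianProductWith _++_ cs ds ⟧ⁿ I ≡ ⟦ cs ⟧ⁿ I ⊔ ⟦ ds ⟧ⁿ I
    ⟦cartesianProduct-++⟧ []       ds = refl
    ⟦cartesianProduct-++⟧ (c ∷ cs) ds = begin
      ⟦ map (c ++_) ds ++ cartesianProductWith _++_ cs ds ⟧ⁿ I
        ≡⟨ ⟦++⟧ⁿ (map (c ++_) ds) (cartesianProductWith _++_ cs ds) ⟩
      ⟦ map (c ++_) ds ⟧ⁿ I ⊓ ⟦ cartesianProductWith _++_ cs ds ⟧ⁿ I
        ≡⟨ cong₂ _⊓_ (⟦map-++⟧ c ds) (⟦cartesianProduct-++⟧ cs ds) ⟩
      (⟦ c ⟧ᶜ I ⊔ ⟦ ds ⟧ⁿ I) ⊓ (⟦ cs ⟧ⁿ I ⊔ ⟦ ds ⟧ⁿ I)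
        ≡⟨ sym (⊔-distribʳ-⊓ (⟦ ds ⟧ⁿ I) (⟦ c ⟧ᶜ I) (⟦ cs ⟧ⁿ I)) ⟩
      (⟦ c ⟧ᶜ I ⊓ ⟦ cs ⟧ⁿ I) ⊔ ⟦ ds ⟧ⁿ I
        ∎

  conj : Bool → CNF → CNF → CNF
  conj true  = _++_
  conj false = cartesianProductWith _++_

  sign : Bool → X → X
  sign true  α = α
  sign false α = neg α

  kleene-sign : ∀ p α → kleene (sign p α) ≡ pol p (kleene α)
  kleene-sign true  α = refl
  kleene-sign false α = kleene-¬ α

  literalCNF : Bool → Atom → X → CNF
  literalCNF p A α = ((A , sign p α) ∷ []) ∷ []

  -- cnf p P is a CNF of P when p = true and of ~ P when p = false.
  cnf : Bool → Formula → CNF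
  cnf p (lit A α) = literalCNF p A α
  cnf p (con c)   = literalCNF p (const c) True
  cnf p (~ P)     = cnf (not p) P
  cnf p (P ∧ᶠ Q)  = conj p (cnf p P) (cnf p Q)
  cnf p (P ∨ᶠ Q)  = conj (not p) (cnf p P) (cnf p Q)
  cnf p (P →ᶠ Q)  = conj (not p) (cnf (not p) P) (cnf p Q)
  cnf p (P ↔ᶠ Q)  = conj p (conj (not p) (cnf (not p) P) (cnf p Q))
                           (conj (not p) (cnf (not p) Q) (cnf p P))

  module _ (I : Interpretation) where

    ⟦conj⟧ : ∀ p cs ds → ⟦ conj p cs ds ⟧ⁿ I ≡ meet p (⟦ cs ⟧ⁿ I) (⟦ ds ⟧ⁿ I)
    ⟦conj⟧ true  = ⟦++⟧ⁿ I
    ⟦conj⟧ false = ⟦cartesianProduct-++⟧ I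

    ⟦conj⟧-⊓ : ∀ p {cs ds x y} → ⟦ cs ⟧ⁿ I ≡ pol p x → ⟦ ds ⟧ⁿ I ≡ pol p y →
               ⟦ conj p cs ds ⟧ⁿ I ≡ pol p (x ⊓ y)
    ⟦conj⟧-⊓ p {cs} {ds} {x} {y} cs≡x ds≡y =
      trans (⟦conj⟧ p cs ds) (trans (cong₂ (meet p) cs≡x ds≡y) (sym (pol-⊓ p x y)))

    ⟦conj⟧-⊔ : ∀ p {cs ds x y} → ⟦ cs ⟧ⁿ I ≡ pol p x → ⟦ ds ⟧ⁿ I ≡ pol p y →
               ⟦ conj (not p) cs ds ⟧ⁿ I ≡ pol p (x ⊔ y)
    ⟦conj⟧-⊔ p {cs} {ds} {x} {y} cs≡x ds≡y =
      trans (⟦conj⟧ (not p) cs ds)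
            (trans (cong₂ (meet (not p)) cs≡x ds≡y) (sym (pol-⊔ p x y)))

    ⟦conj⟧-⇒ : ∀ p {cs ds x y} → ⟦ cs ⟧ⁿ I ≡ pol (not p) x → ⟦ ds ⟧ⁿ I ≡ pol p y →
               ⟦ conj (not p) cs ds ⟧ⁿ I ≡ pol p (∼ x ⊔ y)
    ⟦conj⟧-⇒ p {x = x} cs≡x ds≡y = ⟦conj⟧-⊔ p (trans cs≡x (pol-not p x)) ds≡y

    ⟦literalCNF⟧ : ∀ p A α → ⟦ literalCNF p A α ⟧ⁿ I ≡ pol p (⟦ lit A α ⟧ I)
    ⟦literalCNF⟧ p A α = begin
      ((kleene a ⇔ kleene (sign p α)) ⊔ F) ⊓ T
        ≡⟨ ⊓-identityʳ _ ⟩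
      (kleene a ⇔ kleene (sign p α)) ⊔ F
        ≡⟨ ⊔-identityʳ _ ⟩
      kleene a ⇔ kleene (sign p α)
        ≡⟨ cong (kleene a ⇔_) (kleene-sign p α) ⟩
      kleene a ⇔ pol p (kleene α)
        ≡⟨ ⇔-pol p (kleene a) (kleene α) ⟩
      pol p (kleene a ⇔ kleene α)
        ∎
      where
      a : X
      a = atomVal I A

    ⟦cnf⟧ : ∀ p P → ⟦ cnf p P ⟧ⁿ I ≡ pol p (⟦ P ⟧ I)
    ⟦cnf⟧ p (lit A α) = ⟦literalCNF⟧ p A α
    ⟦cnf⟧ p (con c)   = trans (⟦literalCNF⟧ p (const c) True) (cong (pol p) c⇔True≡c)
      where
      c⇔True≡c : kleene c ⇔ kleene True ≡ kleene c
      c⇔True≡c = trans (cong (kleene c ⇔_) kleene-True) (⇔-identityʳ (kleene c))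
    ⟦cnf⟧ p (~ P)     = trans (⟦cnf⟧ (not p) P) (pol-not p (⟦ P ⟧ I))
    ⟦cnf⟧ p (P ∧ᶠ Q)  = ⟦conj⟧-⊓ p (⟦cnf⟧ p P) (⟦cnf⟧ p Q)
    ⟦cnf⟧ p (P ∨ᶠ Q)  = ⟦conj⟧-⊔ p (⟦cnf⟧ p P) (⟦cnf⟧ p Q)
    ⟦cnf⟧ p (P →ᶠ Q)  = ⟦conj⟧-⇒ p (⟦cnf⟧ (not p) P) (⟦cnf⟧ p Q)
    ⟦cnf⟧ p (P ↔ᶠ Q)  = ⟦conj⟧-⊓ p (⟦conj⟧-⇒ p (⟦cnf⟧ (not p) P) (⟦cnf⟧ p Q))
                                   (⟦conj⟧-⇒ p (⟦cnf⟧ (not p) Q) (⟦cnf⟧ p P))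

  toCNF : Formula → Formula
  toCNF P = cnfFormula (cnf true P)

  ⟦toCNF⟧ : ∀ P I → ⟦ toCNF P ⟧ I ≡ ⟦ P ⟧ I
  ⟦toCNF⟧ P I = trans (⟦cnfFormula⟧ I (cnf true P)) (⟦cnf⟧ I true P)

  toCNF-equivalent : ∀ P → P ⊨ toCNF P × toCNF P ⊨ P
  toCNF-equivalent P =
    ⟦⟧-≡⇒⊨ {P} {toCNF P} (λ I → sym (⟦toCNF⟧ P I)) ,
    ⟦⟧-≡⇒⊨ {toCNF P} {P} (⟦toCNF⟧ P)

theorem1 : (T : TruthDomain) → let open Syntax T in
    (F : Formula) → Σ Formula (λ F′ → IsCNF F′ × (F ⊨ F′) × (F′ ⊨ F))
theorem1 𝒯 P =
  toCNF P , cnfFormula-isCNF (cnf true P) , toCNF-equivalent P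
  where open ClausalForm 𝒯
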